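{- If $v$ and $w$ are two equivalent operation sequences having the same type, then for each $i$, the $i$-th operation of $v$ moves the same item as the $i$-th operation of $w$.
   Context: Two parallel stacks: input items $1,\dots,n$ arrive in the order $1,2,\dots,n$. An operation sequence is a word over $\{I_1,I_2,O_1,O_2\}$ ($I_i$ pushes the next input item onto stack $i$, $O_i$ pops the top of stack $i$ to the output) with as many $I_i$ as $O_i$ for $i=1,2$ and every prefix having at least as many $I_i$ as $O_i$; it produces the permutation given by the output order. Equivalent: producing the same permutation. Type: the word over $\{I,O\}$ obtained by deleting subscripts. An operation moves the item it pushes (for $I_i$) or pops (for $O_i$). -}

module Defs where

open import Data.Nat using (ℕ; zero; suc; _+_; _≤_)
open import Data.List using (List; []; _∷_; take; map)
open import Data.Product using (_×_; _,_)
open import Relation.Binary.PropositionalEquality using (_≡_)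

data Stack : Set where
  s₁ s₂ : Stack

-- operations I₁, I₂, O₁, O₂ : (push s) = I_s , (pop s) = O_s
data Op : Set where
  push pop : Stack → Op

data IO : Set where
  I O : IO

erase : Op → IO
erase (push _) = I
erase (pop _)  = O

typeOf : List Op → List IO
typeOf = map erase

sameStack : Stack → Stack → ℕ
sameStack s₁ s₁ = 1
sameStack s₂ s₂ = 1
sameStack _  _  = 0

#push : Stack → List Op → ℕ
#push s []             = 0
#push s (push t ∷ w)   = sameStack s t + #push s w
#push s (pop _ ∷ w)    = #push s w

#pop : Stack → List Op → ℕ
#pop s []             = 0
#pop s (pop t ∷ w)    = sameStack s t + #pop s w
#pop s (push _ ∷ w)   = #pop s w

OpSeq : List Op → Set
OpSeq w = ∀ (s : Stack) →
  (#push s w ≡ #pop s w) × (∀ (k : ℕ) → #pop s (take k w) ≤ #push s (take k w))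

-- machine state: next input item, contents of stack 1 and stack 2 (top first)
record State : Set where
  constructor ⟨_,_,_⟩
  field
    next : ℕ
    st₁  : List ℕ
    st₂  : List ℕ

getSt : Stack → State → List ℕ
getSt s₁ ⟨ _ , a , _ ⟩ = a
getSt s₂ ⟨ _ , _ , b ⟩ = b

setSt : Stack → List ℕ → State → State
setSt s₁ a ⟨ n , _ , b ⟩ = ⟨ n , a , b ⟩
setSt s₂ b ⟨ n , a , _ ⟩ = ⟨ n , a , b ⟩

-- one step: returns the item moved and the new state.
-- (Popping an empty stack never happens for an operation sequence; 0 is a dummy.)
step : Op → State → ℕ × State
step (push s) σ with σ
... | ⟨ n , a , b ⟩ = n , setSt s (n ∷ getSt s σ) ⟨ suc n , a , b ⟩
step (pop s) σ with getSt s σ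
... | []     = 0 , σ
... | x ∷ xs = x , setSt s xs σ

movesFrom : State → List Op → List ℕ
movesFrom σ []      = []
movesFrom σ (o ∷ w) with step o σ
... | x , σ' = x ∷ movesFrom σ' w

moves : List Op → List ℕ
moves = movesFrom ⟨ 1 , [] , [] ⟩

outputFrom : State → List Op → List ℕ
outputFrom σ []            = []
outputFrom σ (push s ∷ w)  with step (push s) σ
... | _ , σ' = outputFrom σ' w
outputFrom σ (pop s ∷ w)   with step (pop s) σ
... | x , σ' = x ∷ outputFrom σ' w

output : List Op → List ℕ
output = outputFrom ⟨ 1 , [] , [] ⟩

Equivalent : List Op → List Op → Set
Equivalent v w = output v ≡ output w

-- An I always moves the next input item, and how far the input has advanced
-- depends only on the number of earlier I's; an O moves the next item of the
-- output.
module Submission where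

open import Defs
open import Data.Nat using (ℕ; suc)
open import Data.List using (List; []; _∷_)
open import Data.Product using (_,_; proj₂)
open import Relation.Binary.PropositionalEquality using (_≡_; refl; cong; cong₂; trans; module ≡-Reasoning)

-- The O's consume the output front to back; an O facing an exhausted output
-- cannot occur for the output of an actual run, so the [] there is junk.
replay : ℕ → List IO → List ℕ → List ℕ
replay n []      out       = []
replay n (I ∷ t) out       = n ∷ replay (suc n) t out
replay n (O ∷ t) []        = []
replay n (O ∷ t) (x ∷ out) = x ∷ replay n t out

next-setSt : ∀ s l σ → State.next (setSt s l σ) ≡ State.next σ
next-setSt s₁ l ⟨ n , a , b ⟩ = refl
next-setSt s₂ l ⟨ n , a , b ⟩ = refl

next-pop : ∀ s σ → State.next (proj₂ (step (pop s) σ)) ≡ State.next σ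
next-pop s σ with getSt s σ
... | []     = refl
... | x ∷ xs = next-setSt s xs σ

movesFrom≡replay : ∀ σ w → movesFrom σ w ≡ replay (State.next σ) (typeOf w) (outputFrom σ w)
movesFrom≡replay σ []                          = refl
movesFrom≡replay σ@(⟨ n , a , b ⟩) (push s ∷ w) =
  cong (n ∷_) (trans (movesFrom≡replay σ' w)
                     (cong (λ m → replay m (typeOf w) (outputFrom σ' w)) (next-setSt s _ _)))
  where σ' = proj₂ (step (push s) σ)
movesFrom≡replay σ (pop s ∷ w) with step (pop s) σ | next-pop s σ
... | x , σ' | refl = cong (x ∷_) (movesFrom≡replay σ' w)

lemma2p4 : (v w : List Op) → OpSeq v → OpSeq w →
    Equivalent v w → typeOf v ≡ typeOf w →
    moves v ≡ moves w
lemma2p4 v w _ _ same-output same-type = begin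
  moves v                          ≡⟨ movesFrom≡replay _ v ⟩
  replay 1 (typeOf v) (output v)   ≡⟨ cong₂ (replay 1) same-type same-output ⟩
  replay 1 (typeOf w) (output w)   ≡⟨ movesFrom≡replay _ w ⟨
  moves w                          ∎
  where open ≡-Reasoning
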